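{- For every positive integer $n$, $f(n)\geq \lfloor n/2\rfloor$; that is, there exists a permutation of $[n]$ that cannot be transformed into the identity permutation $[1\,2\,\cdots\,n]$ using fewer than $\lfloor n/2\rfloor$ cut-and-paste moves.
   Context: Let $[n]=\{1,\ldots,n\}$ and write a permutation of $[n]$ as a string $\pi_1\pi_2\cdots\pi_n$. A cut-and-paste move consists of cutting a (contiguous) substring out of the permutation, optionally reversing it, and then pasting it back into the remaining string at any position. Define $f(n)$ to be the maximum, over all permutations $\pi$ of $[n]$, of the minimum number of cut-and-paste moves needed to transform $\pi$ into the identity permutation $[1\,2\,\cdots\,n]$. -}

module Defs where

open import Data.Nat using (ℕ; zero; suc)
open import Data.List using (List; []; _∷_; _++_; reverse; take; drop; upTo; map)

idPerm : ℕ → List ℕ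
idPerm n = map suc (upTo n)

-- One cut-and-paste move: cut the contiguous substring s out of a ++ s ++ b,
-- optionally reverse it, and paste it back into the remaining string a ++ b
-- at any position k (i.e. after the first k entries of the remainder).
data CutPaste : List ℕ → List ℕ → Set where
  keep : (a s b : List ℕ) (k : ℕ) →
         CutPaste (a ++ s ++ b)
                  (take k (a ++ b) ++ s ++ drop k (a ++ b))
  rev  : (a s b : List ℕ) (k : ℕ) →
         CutPaste (a ++ s ++ b)
                  (take k (a ++ b) ++ reverse s ++ drop k (a ++ b))

data Reach : ℕ → List ℕ → List ℕ → Set where
  done : (π : List ℕ) → Reach zero π π
  step : {k : ℕ} {π ρ σ : List ℕ} → CutPaste π ρ → Reach k ρ σ → Reach (suc k) π σ

-- Frame an arrangement of [n] by the sentinels 0 and n + 1 and count its "bonds": adjacent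
-- pairs of equal parity. The identity has no bond, whereas all evens followed by all odds has
-- at least n − 1. A move cuts the three adjacencies at the ends of the segment and of the gap
-- it is pasted into, and creates three new ones on the same six endpoints; the number of parity
-- changes among them is therefore preserved mod 2, so three bonds are never destroyed without
-- creating one. Each move thus removes at most two bonds, and at least ⌈(n − 1)/2⌉ = ⌊n/2⌋
-- moves are needed.

{-# OPTIONS --safe #-}
module Submission where

open import Defs
open import Data.Nat using (ℕ; suc; _≤_; _<_; _/_)
open import Data.List using (List)
open import Data.List.Relation.Binary.Permutation.Propositional using (_↭_)
open import Data.Product using (Σ; _×_)
open import Relation.Nullary using (¬_)

open import Data.Nat using (zero; _+_; _*_; z≤n; s≤s; parity)
open import Data.Nat.Properties
  using (≤-trans; ≤-reflexive; <-irrefl; _≤?_; +-comm; +-assoc; +-identityʳ; +-suc;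
         m≤m+n; m≤n+m; +-monoʳ-≤; +-monoˡ-≤; +-cancelʳ-≤; *-monoˡ-≤; module ≤-Reasoning)
open import Data.Nat.DivMod using (m/n*n≤m)
open import Data.Nat.Tactic.RingSolver using (solve-∀)
open import Data.Parity.Base using (Parity; 0ℙ; 1ℙ; _⁻¹)
open import Data.Parity.Properties using (suc-homo-⁻¹) renaming (_≟_ to _≟ℙ_)
open import Data.List using ([]; _∷_; _++_; _∷ʳ_; [_]; reverse; take; drop; upTo; map; length; partition)
open import Data.List.Properties
  using (++-assoc; take++drop≡id; unfold-reverse; length-++; length-map; length-upTo; upTo-∷ʳ; map-++)
open import Relation.Binary.PropositionalEquality
  using (_≡_; _≢_; refl; sym; trans; cong; cong₂; subst₂; setoid; module ≡-Reasoning)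
open import Data.List.Relation.Binary.Permutation.Propositional using (↭-sym; ↭ₛ⇒↭)
open import Data.List.Relation.Binary.Permutation.Propositional.Properties using (↭-length)
open import Data.List.Relation.Binary.Permutation.Setoid.Properties (setoid ℕ) using (partition-↭)
open import Data.List.Relation.Unary.All using (All; []; _∷_) renaming (map to All-map)
open import Data.List.Relation.Unary.All.Properties using (partition-All)
open import Data.Product using (_,_; proj₁; proj₂; ∃₂; uncurry)
open import Relation.Nullary using (Dec; contradiction; from-yes; map′; _×-dec_)

private
  variable
    A : Set

agree : Parity → Parity → ℕ
agree 0ℙ 0ℙ = 1
agree 1ℙ 1ℙ = 1
agree _  _  = 0

agree-sym : ∀ p q → agree p q ≡ agree q p
agree-sym 0ℙ 0ℙ = refl
agree-sym 0ℙ 1ℙ = refl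
agree-sym 1ℙ 0ℙ = refl
agree-sym 1ℙ 1ℙ = refl

agree-≡ : ∀ {p q} → p ≡ q → agree p q ≡ 1
agree-≡ {0ℙ} refl = refl
agree-≡ {1ℙ} refl = refl

agree-⁻¹ : ∀ p → agree (p ⁻¹) p ≡ 0
agree-⁻¹ 0ℙ = refl
agree-⁻¹ 1ℙ = refl

≢⇒≡⁻¹ : ∀ {p q : Parity} → p ≢ q → p ≡ q ⁻¹
≢⇒≡⁻¹ {0ℙ} {0ℙ} p≢q = contradiction refl p≢q
≢⇒≡⁻¹ {0ℙ} {1ℙ} _   = refl
≢⇒≡⁻¹ {1ℙ} {0ℙ} _   = refl
≢⇒≡⁻¹ {1ℙ} {1ℙ} p≢q = contradiction refl p≢q

∀-Parity? : {P : Parity → Set} → (∀ p → Dec (P p)) → Dec (∀ p → P p)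
∀-Parity? P? =
  map′ (λ (P0 , P1) → λ { 0ℙ → P0 ; 1ℙ → P1 }) (λ ∀P → ∀P 0ℙ , ∀P 1ℙ) (P? 0ℙ ×-dec P? 1ℙ)

-- A segment h … ω moves from between α and β into the gap between γ and δ.
agree-reconnect : ∀ α h ω β γ δ →
  agree α h + agree ω β + agree γ δ ≤ agree γ h + agree ω δ + agree α β + 2
agree-reconnect = from-yes
  (∀-Parity? λ α → ∀-Parity? λ h → ∀-Parity? λ ω →
   ∀-Parity? λ β → ∀-Parity? λ γ → ∀-Parity? λ δ →
    agree α h + agree ω β + agree γ δ ≤? agree γ h + agree ω δ + agree α β + 2)

replace-summand-≤ : ∀ {c} a m s s' x y p q → a + (x + p) ≡ m + (y + q) → s + y ≤ s' + x + c →
                    a + (s + p) ≤ m + (s' + q) + c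
replace-summand-≤ {c} a m s s' x y p q eq s+y≤s'+x+c = +-cancelʳ-≤ (x + y) _ _ (begin
  a + (s + p) + (x + y)        ≡⟨ regroupˡ a s p x y ⟩
  a + (x + p) + (s + y)        ≤⟨ +-monoʳ-≤ (a + (x + p)) s+y≤s'+x+c ⟩
  a + (x + p) + (s' + x + c)   ≡⟨ cong (_+ (s' + x + c)) eq ⟩
  m + (y + q) + (s' + x + c)   ≡⟨ regroupʳ m y q s' x c ⟩
  m + (s' + q) + c + (x + y)   ∎)
  where
  open ≤-Reasoning
  regroupˡ : ∀ a s p x y → a + (s + p) + (x + y) ≡ a + (x + p) + (s + y)
  regroupˡ = solve-∀
  regroupʳ : ∀ m y q s' x c → m + (y + q) + (s' + x + c) ≡ m + (s' + q) + c + (x + y)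
  regroupʳ = solve-∀

lastOf : A → List A → A
lastOf x []      = x
lastOf _ (y ∷ l) = lastOf y l

lastOf-∷ʳ : ∀ (x : A) l y → lastOf x (l ∷ʳ y) ≡ y
lastOf-∷ʳ x []      y = refl
lastOf-∷ʳ x (z ∷ l) y = lastOf-∷ʳ z l y

∷ʳ-nonEmpty : ∀ (l : List A) y → ∃₂ λ w W → l ∷ʳ y ≡ w ∷ W
∷ʳ-nonEmpty []      y = y , [] , refl
∷ʳ-nonEmpty (z ∷ l) y = z , l ∷ʳ y , refl

module Bonds (colour : ℕ → Parity) where

  bond : ℕ → ℕ → ℕ
  bond x y = agree (colour x) (colour y)

  bonds : ℕ → List ℕ → ℕ
  bonds x []      = 0
  bonds x (y ∷ l) = bond x y + bonds y l

  bonds-++ : ∀ x u v → bonds x (u ++ v) ≡ bonds x u + bonds (lastOf x u) v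
  bonds-++ x []      v = refl
  bonds-++ x (y ∷ u) v = trans (cong (bond x y +_) (bonds-++ y u v)) (sym (+-assoc (bond x y) _ _))

  bonds-∷ʳ : ∀ x l y → bonds x (l ∷ʳ y) ≡ bonds x l + bond (lastOf x l) y
  bonds-∷ʳ x l y = trans (bonds-++ x l [ y ]) (cong (bonds x l +_) (+-identityʳ _))

  bonds-++-∷ : ∀ x s w W → bonds x (s ++ w ∷ W) ≡ bonds x (s ∷ʳ w) + bonds w W
  bonds-++-∷ x s w W = begin
    bonds x (s ++ w ∷ W)                             ≡⟨ cong (bonds x) (sym (++-assoc s [ w ] W)) ⟩
    bonds x ((s ∷ʳ w) ++ W)                          ≡⟨ bonds-++ x (s ∷ʳ w) W ⟩
    bonds x (s ∷ʳ w) + bonds (lastOf x (s ∷ʳ w)) W   ≡⟨ cong (λ z → bonds x (s ∷ʳ w) + bonds z W)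
                                                            (lastOf-∷ʳ x s w) ⟩
    bonds x (s ∷ʳ w) + bonds w W                     ∎
    where open ≡-Reasoning

  bonds-++-∷ʳ : ∀ x a t y → bonds x ((a ++ t) ∷ʳ y) ≡ bonds x a + bonds (lastOf x a) (t ∷ʳ y)
  bonds-++-∷ʳ x a t y = trans (cong (bonds x) (++-assoc a t [ y ])) (bonds-++ x a (t ∷ʳ y))

  bonds-splice : ∀ x a s b y w W → b ∷ʳ y ≡ w ∷ W →
                 bonds x ((a ++ s ++ b) ∷ʳ y) ≡ bonds x a + (bonds (lastOf x a) (s ∷ʳ w) + bonds w W)
  bonds-splice x a s b y w W b∷ʳy≡w∷W = begin
    bonds x ((a ++ s ++ b) ∷ʳ y)                   ≡⟨ bonds-++-∷ʳ x a (s ++ b) y ⟩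
    bonds x a + bonds α ((s ++ b) ∷ʳ y)            ≡⟨ cong (λ t → bonds x a + bonds α t) (++-assoc s b [ y ]) ⟩
    bonds x a + bonds α (s ++ b ∷ʳ y)              ≡⟨ cong (λ t → bonds x a + bonds α (s ++ t)) b∷ʳy≡w∷W ⟩
    bonds x a + bonds α (s ++ w ∷ W)               ≡⟨ cong (bonds x a +_) (bonds-++-∷ α s w W) ⟩
    bonds x a + (bonds α (s ∷ʳ w) + bonds w W)     ∎
    where
    open ≡-Reasoning
    α = lastOf x a

  bonds-reverse : ∀ x l y → bonds x (reverse l ∷ʳ y) ≡ bonds y (l ∷ʳ x)
  bonds-reverse x []      y = cong (_+ 0) (agree-sym (colour x) (colour y))
  bonds-reverse x (z ∷ l) y = begin
    bonds x (reverse (z ∷ l) ∷ʳ y)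
      ≡⟨ cong (λ r → bonds x (r ∷ʳ y)) (unfold-reverse z l) ⟩
    bonds x (reverse l ∷ʳ z ∷ʳ y)
      ≡⟨ bonds-∷ʳ x (reverse l ∷ʳ z) y ⟩
    bonds x (reverse l ∷ʳ z) + bond (lastOf x (reverse l ∷ʳ z)) y
      ≡⟨ cong₂ _+_ (bonds-reverse x l z) (cong (λ r → bond r y) (lastOf-∷ʳ x (reverse l) z)) ⟩
    bonds z (l ∷ʳ x) + bond z y
      ≡⟨ +-comm _ (bond z y) ⟩
    bond z y + bonds z (l ∷ʳ x)
      ≡⟨ cong (_+ bonds z (l ∷ʳ x)) (agree-sym (colour z) (colour y)) ⟩
    bonds y ((z ∷ l) ∷ʳ x)
      ∎
    where open ≡-Reasoning

  bonds-reconnect : ∀ α s β γ δ → bonds α (s ∷ʳ β) + bond γ δ ≤ bonds γ (s ∷ʳ δ) + bond α β + 2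
  bonds-reconnect α [] β γ δ = ≤-trans (≤-reflexive (swap (bond α β) (bond γ δ))) (m≤m+n _ 2)
    where
    swap : ∀ a b → a + 0 + b ≡ b + 0 + a
    swap = solve-∀
  bonds-reconnect α (h ∷ r) β γ δ = begin
    bond α h + bonds h (r ∷ʳ β) + bond γ δ
      ≡⟨ cong (λ t → bond α h + t + bond γ δ) (bonds-∷ʳ h r β) ⟩
    bond α h + (bonds h r + bond ω β) + bond γ δ
      ≡⟨ pull (bond α h) (bonds h r) (bond ω β) (bond γ δ) ⟩
    bonds h r + (bond α h + bond ω β + bond γ δ)
      ≤⟨ +-monoʳ-≤ (bonds h r)
           (agree-reconnect (colour α) (colour h) (colour ω) (colour β) (colour γ) (colour δ)) ⟩
    bonds h r + (bond γ h + bond ω δ + bond α β + 2)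
      ≡⟨ push (bonds h r) (bond γ h) (bond ω δ) (bond α β) ⟩
    bond γ h + (bonds h r + bond ω δ) + bond α β + 2
      ≡⟨ cong (λ t → bond γ h + t + bond α β + 2) (bonds-∷ʳ h r δ) ⟨
    bond γ h + bonds h (r ∷ʳ δ) + bond α β + 2
      ∎
    where
    open ≤-Reasoning
    ω = lastOf h r
    pull : ∀ a r b c → a + (r + b) + c ≡ r + (a + b + c)
    pull = solve-∀
    push : ∀ r a b c → r + (a + b + c + 2) ≡ a + (r + b) + c + 2
    push = solve-∀

  Reconnects : ℕ → ℕ → List ℕ → List ℕ → Set
  Reconnects α γ s s' = ∀ w v → bonds α (s ∷ʳ w) + bond γ v ≤ bonds γ (s' ∷ʳ v) + bond α w + 2

  reconnects-keep : ∀ α γ s → Reconnects α γ s s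
  reconnects-keep α γ s w v = bonds-reconnect α s w γ v

  reconnects-reverse : ∀ α γ s → Reconnects α γ s (reverse s)
  reconnects-reverse α γ s w v =
    subst₂ (λ p q → bonds α (s ∷ʳ w) + p ≤ q + bond α w + 2)
      (agree-sym (colour v) (colour γ)) (sym (bonds-reverse γ s v)) (bonds-reconnect α s w v γ)

  bonds-resplice : ∀ x y a s b m s' m' → a ++ b ≡ m ++ m' → Reconnects (lastOf x a) (lastOf x m) s s' →
                   bonds x ((a ++ s ++ b) ∷ʳ y) ≤ bonds x ((m ++ s' ++ m') ∷ʳ y) + 2
  bonds-resplice x y a s b m s' m' a++b≡m++m' reconnects
    with ∷ʳ-nonEmpty b y | ∷ʳ-nonEmpty m' y
  ... | w , W , b∷ʳy≡w∷W | v , V , m'∷ʳy≡v∷V = begin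
    bonds x ((a ++ s ++ b) ∷ʳ y)                    ≡⟨ bonds-splice x a s b y w W b∷ʳy≡w∷W ⟩
    bonds x a + (bonds α (s ∷ʳ w) + bonds w W)      ≤⟨ replace-summand-≤ (bonds x a) (bonds x m)
                                                         (bonds α (s ∷ʳ w)) (bonds γ (s' ∷ʳ v))
                                                         (bond α w) (bond γ v) (bonds w W) (bonds v V)
                                                         remainder (reconnects w v) ⟩
    bonds x m + (bonds γ (s' ∷ʳ v) + bonds v V) + 2 ≡⟨ cong (_+ 2)
                                                         (bonds-splice x m s' m' y v V m'∷ʳy≡v∷V) ⟨
    bonds x ((m ++ s' ++ m') ∷ʳ y) + 2              ∎
    where
    open ≤-Reasoning
    α = lastOf x a
    γ = lastOf x m
    remainder : bonds x a + bonds α (w ∷ W) ≡ bonds x m + bonds γ (v ∷ V)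
    remainder = begin-equality
      bonds x a + bonds α (w ∷ W)     ≡⟨ cong (λ t → bonds x a + bonds α t) b∷ʳy≡w∷W ⟨
      bonds x a + bonds α (b ∷ʳ y)    ≡⟨ bonds-++-∷ʳ x a b y ⟨
      bonds x ((a ++ b) ∷ʳ y)         ≡⟨ cong (λ r → bonds x (r ∷ʳ y)) a++b≡m++m' ⟩
      bonds x ((m ++ m') ∷ʳ y)        ≡⟨ bonds-++-∷ʳ x m m' y ⟩
      bonds x m + bonds γ (m' ∷ʳ y)   ≡⟨ cong (λ t → bonds x m + bonds γ t) m'∷ʳy≡v∷V ⟩
      bonds x m + bonds γ (v ∷ V)     ∎

  bonds-cutPaste : ∀ x y {l l'} → CutPaste l l' → bonds x (l ∷ʳ y) ≤ bonds x (l' ∷ʳ y) + 2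
  bonds-cutPaste x y (keep a s b k) =
    bonds-resplice x y a s b (take k (a ++ b)) s (drop k (a ++ b))
      (sym (take++drop≡id k (a ++ b))) (reconnects-keep _ _ s)
  bonds-cutPaste x y (rev a s b k) =
    bonds-resplice x y a s b (take k (a ++ b)) (reverse s) (drop k (a ++ b))
      (sym (take++drop≡id k (a ++ b))) (reconnects-reverse _ _ s)

  bonds-reach : ∀ x y {k l l'} → Reach k l l' → bonds x (l ∷ʳ y) ≤ bonds x (l' ∷ʳ y) + k * 2
  bonds-reach x y (done l) = m≤m+n _ 0
  bonds-reach x y {suc k} {l} {l'} (step {ρ = ρ} move moves) = begin
    bonds x (l ∷ʳ y)                ≤⟨ bonds-cutPaste x y move ⟩
    bonds x (ρ ∷ʳ y) + 2            ≤⟨ +-monoˡ-≤ 2 (bonds-reach x y moves) ⟩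
    bonds x (l' ∷ʳ y) + k * 2 + 2   ≡⟨ +-assoc (bonds x (l' ∷ʳ y)) (k * 2) 2 ⟩
    bonds x (l' ∷ʳ y) + (k * 2 + 2) ≡⟨ cong (bonds x (l' ∷ʳ y) +_) (+-comm (k * 2) 2) ⟩
    bonds x (l' ∷ʳ y) + suc k * 2   ∎
    where open ≤-Reasoning

  monochromatic-bonds : ∀ {p x l} → colour x ≡ p → All (λ z → colour z ≡ p) l → bonds x l ≡ length l
  monochromatic-bonds x≡p []          = refl
  monochromatic-bonds x≡p (z≡p ∷ l≡p) =
    cong₂ _+_ (agree-≡ (trans x≡p (sym z≡p))) (monochromatic-bonds z≡p l≡p)

  monochromatic-length≤ : ∀ {p} x {l} → All (λ z → colour z ≡ p) l → length l ≤ suc (bonds x l)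
  monochromatic-length≤ x []          = z≤n
  monochromatic-length≤ x (z≡p ∷ l≡p) =
    s≤s (≤-trans (≤-reflexive (sym (monochromatic-bonds z≡p l≡p))) (m≤n+m _ _))

  twoBlocks-length≤ : ∀ {p q x u v} → colour x ≡ p →
                      All (λ z → colour z ≡ p) u → All (λ z → colour z ≡ q) v →
                      length (u ++ v) ≤ suc (bonds x (u ++ v))
  twoBlocks-length≤ {x = x} {u} {v} x≡p u≡p v≡q = begin
    length (u ++ v)                          ≡⟨ length-++ u ⟩
    length u + length v                      ≤⟨ +-monoʳ-≤ (length u) (monochromatic-length≤ (lastOf x u) v≡q) ⟩
    length u + suc (bonds (lastOf x u) v)    ≡⟨ +-suc (length u) _ ⟩
    suc (length u + bonds (lastOf x u) v)    ≡⟨ cong (λ t → suc (t + bonds (lastOf x u) v))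
                                                     (monochromatic-bonds x≡p u≡p) ⟨
    suc (bonds x u + bonds (lastOf x u) v)   ≡⟨ cong suc (bonds-++ x u v) ⟨
    suc (bonds x (u ++ v))                   ∎
    where open ≤-Reasoning

open Bonds parity

idPerm-suc : ∀ n → idPerm (suc n) ≡ idPerm n ∷ʳ suc n
idPerm-suc n = trans (cong (map suc) (sym (upTo-∷ʳ n))) (map-++ suc (upTo n) [ n ])

length-idPerm : ∀ n → length (idPerm n) ≡ n
length-idPerm n = trans (length-map suc (upTo n)) (length-upTo n)

lastOf-idPerm : ∀ n → lastOf 0 (idPerm n) ≡ n
lastOf-idPerm zero    = refl
lastOf-idPerm (suc n) = trans (cong (lastOf 0) (idPerm-suc n)) (lastOf-∷ʳ 0 (idPerm n) (suc n))

bond-suc : ∀ n → bond n (suc n) ≡ 0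
bond-suc n = trans (cong (λ p → agree p (parity (suc n))) (sym (suc-homo-⁻¹ n))) (agree-⁻¹ (parity (suc n)))

bonds-idPerm : ∀ n → bonds 0 (idPerm n) ≡ 0
bonds-idPerm zero    = refl
bonds-idPerm (suc n) = begin
  bonds 0 (idPerm (suc n))                                ≡⟨ cong (bonds 0) (idPerm-suc n) ⟩
  bonds 0 (idPerm n ∷ʳ suc n)                             ≡⟨ bonds-∷ʳ 0 (idPerm n) (suc n) ⟩
  bonds 0 (idPerm n) + bond (lastOf 0 (idPerm n)) (suc n) ≡⟨ cong₂ (λ b z → b + bond z (suc n))
                                                                   (bonds-idPerm n) (lastOf-idPerm n) ⟩
  bond n (suc n)                                          ≡⟨ bond-suc n ⟩
  0                                                       ∎
  where open ≡-Reasoning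

potential : ℕ → List ℕ → ℕ
potential n l = bonds 0 (l ∷ʳ suc n)

potential-idPerm : ∀ n → potential n (idPerm n) ≡ 0
potential-idPerm n = trans (cong (bonds 0) (sym (idPerm-suc n))) (bonds-idPerm (suc n))

even? : (z : ℕ) → Dec (parity z ≡ 0ℙ)
even? z = parity z ≟ℙ 0ℙ

evensThenOdds : ℕ → List ℕ
evensThenOdds n = uncurry _++_ (partition even? (idPerm n))

evensThenOdds-↭ : ∀ n → evensThenOdds n ↭ idPerm n
evensThenOdds-↭ n = ↭-sym (↭ₛ⇒↭ (partition-↭ even? (idPerm n)))

evensThenOdds-potential : ∀ n → n ≤ suc (potential n (evensThenOdds n))
evensThenOdds-potential n = begin
  n                                        ≡⟨ length-idPerm n ⟨
  length (idPerm n)                        ≡⟨ ↭-length (evensThenOdds-↭ n) ⟨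
  length (evensThenOdds n)                 ≤⟨ twoBlocks-length≤ refl evens (All-map ≢⇒≡⁻¹ odds) ⟩
  suc (bonds 0 (evensThenOdds n))          ≤⟨ s≤s (m≤m+n _ _) ⟩
  suc (bonds 0 (evensThenOdds n) + _)      ≡⟨ cong suc (bonds-∷ʳ 0 (evensThenOdds n) (suc n)) ⟨
  suc (potential n (evensThenOdds n))      ∎
  where
  open ≤-Reasoning
  blocks = partition-All even? (idPerm n)
  evens = proj₁ blocks
  odds = proj₂ blocks

mainTheorem1 : (n : ℕ) → 1 ≤ n →
    Σ (List ℕ) (λ π → (π ↭ idPerm n) ×
      ((k : ℕ) → k < n / 2 → ¬ Reach k π (idPerm n)))
mainTheorem1 n _ = evensThenOdds n , evensThenOdds-↭ n , unreachable
  where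
  unreachable : (k : ℕ) → k < n / 2 → ¬ Reach k (evensThenOdds n) (idPerm n)
  unreachable k k<n/2 moves = <-irrefl refl (≤-trans 2k+2≤n n≤2k+1)
    where
    2k+2≤n : suc k * 2 ≤ n
    2k+2≤n = ≤-trans (*-monoˡ-≤ 2 k<n/2) (m/n*n≤m n 2)
    n≤2k+1 : n ≤ suc (k * 2)
    n≤2k+1 = begin
      n                                     ≤⟨ evensThenOdds-potential n ⟩
      suc (potential n (evensThenOdds n))   ≤⟨ s≤s (bonds-reach 0 (suc n) moves) ⟩
      suc (potential n (idPerm n) + k * 2)  ≡⟨ cong (λ b → suc (b + k * 2)) (potential-idPerm n) ⟩
      suc (k * 2)                           ∎
      where open ≤-Reasoning
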